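{- Let $n\ge 0$, $k\ge1$, and let $\pi$ be any permutation of $\{1,2,3\}$. (i) Among the $\binom{n-1}{k-1}$ compositions of $n$ into $k$ positive parts, the number that avoid $\pi$ does not depend on $\pi$. (ii) Among the $\binom{n+k-1}{n}$ compositions of $n$ into $k$ nonnegative parts, the number that avoid $\pi$ does not depend on $\pi$.
   Context: A composition of $n$ into $k$ positive (resp. nonnegative) parts is a sequence $(x_1,\dots,x_k)$ of positive (resp. nonnegative) integers with $x_1+\dots+x_k=n$; order matters. A sequence $(x_1,\dots,x_k)$ contains the pattern $\pi=(\pi_1\pi_2\pi_3)\in S_3$ if there exist indices $i_1<i_2<i_3$ such that for all $a,b\in\{1,2,3\}$, $x_{i_a}<x_{i_b}$ whenever $\pi_a<\pi_b$ (strict inequalities). It avoids $\pi$ if it does not contain $\pi$. -}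

module Defs where

open import Data.Nat using (ℕ; zero; suc; _+_; _<ᵇ_)
open import Data.Bool using (Bool; true; false; _∧_; _∨_; not; if_then_else_)
open import Data.Fin using (Fin; toℕ)
open import Data.Fin.Permutation using (Permutation′; _⟨$⟩ʳ_)
open import Data.List using (List; []; _∷_; map; concatMap; filter; length; upTo; allFin)
open import Data.Vec using (Vec; []; _∷_; lookup)
open import Data.Bool using (T)
open import Relation.Nullary.Decidable using (T?)

-- A pattern of length 3: a permutation π of {1,2,3}, encoded as a bijection
-- Fin 3 → Fin 3 (π_a = π ⟨$⟩ʳ a, values 0,1,2 standing for 1,2,3).
Perm3 : Set
Perm3 = Permutation′ 3

weakComps : ℕ → (k : ℕ) → List (Vec ℕ k)
weakComps n zero = go n
  where
  go : ℕ → List (Vec ℕ zero)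
  go zero = [] ∷ []
  go (suc _) = []
weakComps n (suc k) = concatMap (λ x₁ → map (x₁ ∷_) (weakComps (n Data.Nat.∸ x₁) k)) (upTo (suc n))

allPos : ∀ {k} → Vec ℕ k → Bool
allPos [] = true
allPos (x ∷ xs) = (0 <ᵇ x) ∧ allPos xs

comps : ℕ → (k : ℕ) → List (Vec ℕ k)
comps n k = filter (λ x → T? (allPos x)) (weakComps n k)

anyL : ∀ {A : Set} → (A → Bool) → List A → Bool
anyL p [] = false
anyL p (x ∷ xs) = p x ∨ anyL p xs

allL : ∀ {A : Set} → (A → Bool) → List A → Bool
allL p [] = true
allL p (x ∷ xs) = p x ∧ allL p xs

idx : ∀ {k} → Fin k → Fin k → Fin k → Fin 3 → Fin k
idx i₁ i₂ i₃ Fin.zero = i₁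
idx i₁ i₂ i₃ (Fin.suc Fin.zero) = i₂
idx i₁ i₂ i₃ (Fin.suc (Fin.suc Fin.zero)) = i₃

-- x contains π: ∃ i₁ < i₂ < i₃ such that for all a b,
-- π_a < π_b implies x_{i_a} < x_{i_b} (strict).  Decided by exhaustive search.
contains : ∀ {k} → Perm3 → Vec ℕ k → Bool
contains {k} π x =
  anyL (λ i₁ → anyL (λ i₂ → anyL (λ i₃ →
     (toℕ i₁ <ᵇ toℕ i₂) ∧ (toℕ i₂ <ᵇ toℕ i₃) ∧
     allL (λ a → allL (λ b →
        not (toℕ (π ⟨$⟩ʳ a) <ᵇ toℕ (π ⟨$⟩ʳ b))
        ∨ (lookup x (idx i₁ i₂ i₃ a) <ᵇ lookup x (idx i₁ i₂ i₃ b)))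
       (allFin 3)) (allFin 3))
     (allFin k)) (allFin k)) (allFin k)

avoids : ∀ {k} → Perm3 → Vec ℕ k → Bool
avoids π x = not (contains π x)

countPos : Perm3 → ℕ → ℕ → ℕ
countPos π n k = length (filter (λ x → T? (avoids π x)) (comps n k))

countNonneg : Perm3 → ℕ → ℕ → ℕ
countNonneg π n k = length (filter (λ x → T? (avoids π x)) (weakComps n k))

module Submission where

-- Reversal of words maps 123 to 321, 132 to 231 and 312 to 213.  The two missing links,
-- 123 ~ 132 and 321 ~ 312, come from a Simion–Schmidt style construction that works over
-- any strict total order ≺ on the letters.  Keep the left-to-right ≺-minima of a word
-- (positions and values) and refill every other position from the multiset of remaining
-- letters, always placing the letter that lies above the current minimum and is least for
-- an auxiliary order ⊏.  For ⊏ = ≺ the result avoids 132, for ⊏ = ≻ it avoids 123; words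
-- already avoiding the pattern are fixed, and the result depends only on the minima and
-- the multiset of the word.  Hence the two canonical forms are mutually inverse between
-- the avoiders of the two patterns.  All maps involved permute the letters, so they
-- preserve the sum and the positivity of the parts.

open import Defs

open import Level using (0ℓ)
open import Function using (_∘_; id; flip)
open import Function.Bundles using (Equivalence; Injection; _⇔_; mk⇔)
open Equivalence using (to; from)
open import Function.Properties.Equivalence using () renaming (trans to ⇔-trans)
open import Function.Properties.Inverse using (↔⇒↣)
open import Data.Empty using (⊥; ⊥-elim)
open import Data.Bool using (Bool; true; false; T; not; _∧_; _∨_)
open import Data.Bool.Properties using (T-∧; T-∨)
open import Data.Maybe using (Maybe; just; nothing)
open import Data.Product using (_×_; _,_; proj₁; proj₂; ∃; ∃₂)
open import Data.Product.Function.NonDependent.Propositional using (_×-⇔_)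
open import Data.Sum as Sum using (_⊎_; inj₁; inj₂)
open import Data.Nat
  using (ℕ; zero; suc; _+_; _∸_; _<ᵇ_; _≤_; _<_; _≥_; z≤n; s≤s; s≤s⁻¹; z<s; s<s; s<s⁻¹)
  renaming (_≟_ to _≟ℕ_)
open import Data.Nat.Properties
  using (<-isStrictTotalOrder; <ᵇ⇒<; <⇒<ᵇ; suc-injective; ≤-antisym; m≤m+n; m+n∸m≡n; m+[n∸m]≡n;
         module ≤-Reasoning)
open import Data.Nat.ListAction using (sum)
open import Data.Nat.ListAction.Properties using (sum-↭)
open import Data.Fin using (Fin; zero; suc; toℕ) renaming (_<_ to _<ᶠ_)
open import Data.Fin.Permutation using (_⟨$⟩ʳ_)
open import Data.List using (List; []; _∷_; _++_; _∷ʳ_; filter; length; reverse; map; upTo; allFin)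
open import Data.List.Properties
  using (unfold-reverse; ∷-injective; ∷-injectiveʳ; filter-reject; filter-++; filter-all; filter-none;
         filter-idem; length-++; ++-assoc; ++-identityʳ)
import Data.List.Extrema as Extrema
open import Data.List.Relation.Unary.Any as Any using (Any; here; there)
import Data.List.Relation.Unary.Any.Properties as Any
open import Data.List.Relation.Unary.All as All using (All; []; _∷_)
import Data.List.Relation.Unary.All.Properties as All
import Data.List.Relation.Unary.AllPairs as AllPairs
import Data.List.Relation.Unary.AllPairs.Properties as AllPairs
open import Data.List.Relation.Unary.Unique.Propositional using (Unique; []; _∷_)
import Data.List.Relation.Unary.Unique.Propositional.Properties as Unique
open import Data.List.Membership.Propositional using (_∈_; find; lose)
open import Data.List.Membership.Propositional.Properties
  using (∈-++⁻; ∈-filter⁻; ∈-filter⁺; ∈-map⁺; ∈-map⁻; ∈-concatMap⁺; ∈-concatMap⁻; ∈-upTo⁺; ∈-upTo⁻)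
open import Data.List.Relation.Binary.Disjoint.Propositional using (Disjoint)
open import Data.List.Relation.Binary.Permutation.Propositional
  using (_↭_; prep; swap; ↭-refl; ↭-reflexive; ↭-sym; ↭-trans; module PermutationReasoning)
open import Data.List.Relation.Binary.Permutation.Propositional.Properties
  using (All-resp-↭; ↭-reverse; ↭-length; ++⁺; ++⁺ˡ; ++⁺ʳ; shift; drop-∷; filter-↭; ∈-resp-↭; ¬x∷xs↭[])
open import Data.Vec using (Vec; []; _∷_; toList; lookup)
import Data.Vec as Vec using (reverse)
import Data.Vec.Properties as Vec
open import Relation.Nullary using (¬_; yes; no)
open import Relation.Nullary.Decidable using (T?)
open import Relation.Unary using (Pred; Decidable)
open import Relation.Unary.Properties using (∁?)
open import Relation.Binary using (Rel; IsStrictTotalOrder; TotalOrder; tri<; tri≈; tri>; DecidableEquality)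
import Relation.Binary.Construct.StrictToNonStrict as NonStrict
import Relation.Binary.Construct.Flip.EqAndOrd as Flip
open import Relation.Binary.PropositionalEquality
  using (_≡_; _≢_; refl; sym; trans; cong; cong₂; subst; subst₂; module ≡-Reasoning)

module _ {A : Set} {P : Pred A 0ℓ} (P? : Decidable P) where

  filter-partition-↭ : ∀ xs → xs ↭ filter P? xs ++ filter (∁? P?) xs
  filter-partition-↭ [] = ↭-refl
  filter-partition-↭ (x ∷ xs) with P? x
  ... | yes _ = prep x (filter-partition-↭ xs)
  ... | no _ = ↭-trans (prep x (filter-partition-↭ xs)) (↭-sym (shift x (filter P? xs) _))

  filter-absorbs : {Q : Pred A 0ℓ} (Q? : Decidable Q) → (∀ {x} → P x → Q x) →
                   ∀ xs → filter P? (filter Q? xs) ≡ filter P? xs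
  filter-absorbs Q? P⇒Q [] = refl
  filter-absorbs Q? P⇒Q (x ∷ xs) with Q? x
  ... | no ¬q = trans (filter-absorbs Q? P⇒Q xs) (sym (filter-reject P? (¬q ∘ P⇒Q)))
  ... | yes _ with P? x
  ...   | yes _ = cong (x ∷_) (filter-absorbs Q? P⇒Q xs)
  ...   | no _ = filter-absorbs Q? P⇒Q xs

module StrictTotalOrderFacts {A : Set} {_<_ : Rel A 0ℓ} (O : IsStrictTotalOrder _≡_ _<_) where

  open IsStrictTotalOrder O public using (_<?_; _≟_; compare; irrefl; asym) renaming (trans to <-trans)

  infix 4 _≼_
  _≼_ : Rel A 0ℓ
  a ≼ b = ¬ (b < a)

  ≼-<-trans : ∀ {a b c} → a ≼ b → b < c → a < c
  ≼-<-trans {a} {b} a≼b b<c with compare a b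
  ... | tri< a<b _ _ = <-trans a<b b<c
  ... | tri≈ _ refl _ = b<c
  ... | tri> _ _ b<a = ⊥-elim (a≼b b<a)

  ≼-trans : ∀ {a b c} → a ≼ b → b ≼ c → a ≼ c
  ≼-trans a≼b b≼c c<a = a≼b (≼-<-trans b≼c c<a)

  ≼-antisym : ∀ {a b} → a ≼ b → b ≼ a → a ≡ b
  ≼-antisym {a} {b} a≼b b≼a with compare a b
  ... | tri< a<b _ _ = ⊥-elim (b≼a a<b)
  ... | tri≈ _ a≡b _ = a≡b
  ... | tri> _ _ b<a = ⊥-elim (a≼b b<a)

module _ {A : Set} (_≟_ : DecidableEquality A) where

  delete : A → List A → List A
  delete x [] = []
  delete x (y ∷ ys) with x ≟ y
  ... | yes _ = ys
  ... | no _ = y ∷ delete x ys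

  delete-↭ : ∀ {x xs} → x ∈ xs → xs ↭ x ∷ delete x xs
  delete-↭ {x} {y ∷ ys} x∈ with x ≟ y
  delete-↭ {x} {y ∷ ys} x∈ | yes refl = ↭-refl
  delete-↭ {x} {y ∷ ys} (here x≡y) | no x≢y = ⊥-elim (x≢y x≡y)
  delete-↭ {x} {y ∷ ys} (there x∈) | no _ = ↭-trans (prep y (delete-↭ x∈)) (swap y x ↭-refl)

  delete-⊆ : ∀ {x z} xs → z ∈ delete x xs → z ∈ xs
  delete-⊆ {x} (y ∷ ys) z∈ with x ≟ y
  delete-⊆ {x} (y ∷ ys) z∈ | yes _ = there z∈
  delete-⊆ {x} (y ∷ ys) (here z≡y) | no _ = here z≡y
  delete-⊆ {x} (y ∷ ys) (there z∈) | no _ = there (delete-⊆ ys z∈)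

  injection-length-≤ : ∀ {xs ys} (h : A → A) → Unique xs → (∀ {x} → x ∈ xs → h x ∈ ys) →
                       (∀ {x y} → x ∈ xs → y ∈ xs → h x ≡ h y → x ≡ y) → length xs ≤ length ys
  injection-length-≤ {[]} h _ _ _ = z≤n
  injection-length-≤ {x ∷ xs} {ys} h (x∉xs ∷ xs!) into injective = begin
    suc (length xs)                  ≤⟨ s≤s (injection-length-≤ h xs! into′ injective′) ⟩
    suc (length (delete (h x) ys))   ≡⟨ ↭-length (delete-↭ (into (here refl))) ⟨
    length ys                        ∎
    where
    open ≤-Reasoning
    injective′ : ∀ {z z′} → z ∈ xs → z′ ∈ xs → h z ≡ h z′ → z ≡ z′
    injective′ z∈ z′∈ = injective (there z∈) (there z′∈)
    into′ : ∀ {z} → z ∈ xs → h z ∈ delete (h x) ys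
    into′ {z} z∈ with ∈-resp-↭ (delete-↭ (into (here refl))) (into (there z∈))
    ... | here hz≡hx = ⊥-elim (All.lookup x∉xs z∈ (sym (injective (there z∈) (here refl) hz≡hx)))
    ... | there hz∈ = hz∈

  module _ {P Q : Pred A 0ℓ} (P? : Decidable P) (Q? : Decidable Q) {L : List A} (L! : Unique L) where

    length-filter-≤ : (f g : A → A) → (∀ {x} → x ∈ L → P x → f x ∈ L × Q (f x)) →
                      (∀ {x} → P x → g (f x) ≡ x) → length (filter P? L) ≤ length (filter Q? L)
    length-filter-≤ f g into g∘f≗id = injection-length-≤ f (Unique.filter⁺ P? L!) into′
      (λ x∈ y∈ fx≡fy → trans (sym (g∘f≗id (P-of x∈))) (trans (cong g fx≡fy) (g∘f≗id (P-of y∈))))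
      where
      P-of : ∀ {x} → x ∈ filter P? L → P x
      P-of x∈ = proj₂ (∈-filter⁻ P? {xs = L} x∈)
      into′ : ∀ {x} → x ∈ filter P? L → f x ∈ filter Q? L
      into′ x∈ = let x∈L , Px = ∈-filter⁻ P? {xs = L} x∈ ; fx∈L , Qfx = into x∈L Px in
                 ∈-filter⁺ Q? fx∈L Qfx

  length-filter-≡ : {P Q : Pred A 0ℓ} (P? : Decidable P) (Q? : Decidable Q) {L : List A} → Unique L →
                    (f g : A → A) →
                    (∀ {x} → x ∈ L → P x → f x ∈ L × Q (f x)) →
                    (∀ {x} → x ∈ L → Q x → g x ∈ L × P (g x)) →
                    (∀ {x} → P x → g (f x) ≡ x) → (∀ {x} → Q x → f (g x) ≡ x) →
                    length (filter P? L) ≡ length (filter Q? L)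
  length-filter-≡ P? Q? L! f g f-into g-into g∘f≗id f∘g≗id = ≤-antisym
    (length-filter-≤ P? Q? L! f g f-into g∘f≗id)
    (length-filter-≤ Q? P? L! g f g-into f∘g≗id)

-- Occurrences of length-3 patterns

module _ {A : Set} where

  Occurs₂ : (A → A → Set) → List A → Set
  Occurs₂ C [] = ⊥
  Occurs₂ C (x ∷ xs) = Any (C x) xs ⊎ Occurs₂ C xs

  Occurs₃ : (A → A → A → Set) → List A → Set
  Occurs₃ C [] = ⊥
  Occurs₃ C (x ∷ xs) = Occurs₂ (C x) xs ⊎ Occurs₃ C xs

  Occurs₂-map : ∀ {C D : A → A → Set} → (∀ {b c} → C b c → D b c) →
                ∀ xs → Occurs₂ C xs → Occurs₂ D xs
  Occurs₂-map f (x ∷ xs) (inj₁ c) = inj₁ (Any.map f c)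
  Occurs₂-map f (x ∷ xs) (inj₂ o) = inj₂ (Occurs₂-map f xs o)

  Occurs₃-map : ∀ {C D : A → A → A → Set} → (∀ {a b c} → C a b c → D a b c) →
                ∀ xs → Occurs₃ C xs → Occurs₃ D xs
  Occurs₃-map f (x ∷ xs) (inj₁ o) = inj₁ (Occurs₂-map f xs o)
  Occurs₃-map f (x ∷ xs) (inj₂ o) = inj₂ (Occurs₃-map f xs o)

  Occurs₂-∷ʳ : ∀ {C : A → A → Set} xs x → Occurs₂ C (xs ∷ʳ x) → Occurs₂ C xs ⊎ Any (λ a → C a x) xs
  Occurs₂-∷ʳ [] x (inj₁ ())
  Occurs₂-∷ʳ [] x (inj₂ ())
  Occurs₂-∷ʳ (y ∷ xs) x (inj₁ y…c) with Any.++⁻ xs y…c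
  ... | inj₁ c∈xs = inj₁ (inj₁ c∈xs)
  ... | inj₂ c≡x = inj₂ (here (Any.singleton⁻ c≡x))
  Occurs₂-∷ʳ (y ∷ xs) x (inj₂ o) = Sum.map inj₂ there (Occurs₂-∷ʳ xs x o)

  Occurs₃-∷ʳ : ∀ {C : A → A → A → Set} xs x → Occurs₃ C (xs ∷ʳ x) →
               Occurs₃ C xs ⊎ Occurs₂ (λ a b → C a b x) xs
  Occurs₃-∷ʳ [] x (inj₁ ())
  Occurs₃-∷ʳ [] x (inj₂ ())
  Occurs₃-∷ʳ (y ∷ xs) x (inj₁ o) = Sum.map inj₁ inj₁ (Occurs₂-∷ʳ xs x o)
  Occurs₃-∷ʳ (y ∷ xs) x (inj₂ o) = Sum.map inj₂ inj₂ (Occurs₃-∷ʳ xs x o)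

  Occurs₂-reverse : ∀ {C : A → A → Set} xs → Occurs₂ C (reverse xs) → Occurs₂ (flip C) xs
  Occurs₂-reverse {C} (x ∷ xs) o with Occurs₂-∷ʳ (reverse xs) x (subst (Occurs₂ C) (unfold-reverse x xs) o)
  ... | inj₁ o′ = inj₂ (Occurs₂-reverse xs o′)
  ... | inj₂ c = inj₁ (Any.reverse⁻ c)

  Occurs₃-reverse : ∀ {C : A → A → A → Set} xs → Occurs₃ C (reverse xs) → Occurs₃ (λ a b c → C c b a) xs
  Occurs₃-reverse {C} (x ∷ xs) o with Occurs₃-∷ʳ (reverse xs) x (subst (Occurs₃ C) (unfold-reverse x xs) o)
  ... | inj₁ o′ = inj₂ (Occurs₃-reverse xs o′)
  ... | inj₂ o′ = inj₁ (Occurs₂-reverse xs o′)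

-- Left-to-right minima and pools

module LeftToRightMinima {A : Set} {_<_ : Rel A 0ℓ} (O : IsStrictTotalOrder _≡_ _<_) where

  open StrictTotalOrderFacts O

  above : A → List A → List A
  above m = filter (m <?_)

  atMost : A → List A → List A
  atMost m = filter (∁? (m <?_))

  between : A → A → List A → List A
  between y m xs = filter (y <?_) (atMost m xs)

  atMost-atMost : ∀ {y m} → y ≼ m → ∀ xs → atMost y (atMost m xs) ≡ atMost y xs
  atMost-atMost {y} {m} y≼m = filter-absorbs (∁? (y <?_)) (∁? (m <?_)) (λ z≼y → ≼-trans z≼y y≼m)

  atMost-split : ∀ {y m} → y ≼ m → ∀ xs → atMost m xs ↭ between y m xs ++ atMost y xs
  atMost-split {y} {m} y≼m xs = begin
    atMost m xs                                ↭⟨ filter-partition-↭ (y <?_) (atMost m xs) ⟩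
    between y m xs ++ atMost y (atMost m xs)   ≡⟨ cong (between y m xs ++_) (atMost-atMost y≼m xs) ⟩
    between y m xs ++ atMost y xs              ∎
    where open PermutationReasoning

  above-++-between : ∀ {y m} → y ≼ m → ∀ xs → above m xs ++ between y m xs ↭ above y xs
  above-++-between {y} {m} y≼m xs = begin
    above m xs ++ between y m xs                    ≡⟨ cong (_++ between y m xs) (filter-all (y <?_) y<above) ⟨
    filter (y <?_) (above m xs) ++ between y m xs   ≡⟨ filter-++ (y <?_) (above m xs) (atMost m xs) ⟨
    filter (y <?_) (above m xs ++ atMost m xs)      ↭⟨ filter-↭ (y <?_) (filter-partition-↭ (m <?_) xs) ⟨
    above y xs                                      ∎
    where
    open PermutationReasoning
    y<above : All (y <_) (above m xs)
    y<above = All.map (≼-<-trans y≼m) (All.all-filter (m <?_) xs)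

  above-++-atMost : ∀ {m P} → All (m <_) P → ∀ xs → above m (P ++ atMost m xs) ≡ P
  above-++-atMost {m} {P} m<P xs = begin
    above m (P ++ atMost m xs)             ≡⟨ filter-++ (m <?_) P (atMost m xs) ⟩
    above m P ++ above m (atMost m xs)     ≡⟨ cong₂ _++_ (filter-all (m <?_) m<P) (filter-none (m <?_) atMost≯m) ⟩
    P ++ []                                ≡⟨ ++-identityʳ P ⟩
    P                                      ∎
    where
    open ≡-Reasoning
    atMost≯m : All (λ z → ¬ m < z) (atMost m xs)
    atMost≯m = All.all-filter (∁? (m <?_)) xs

  atMost-++-atMost : ∀ {m P} → All (m <_) P → ∀ xs → atMost m (P ++ atMost m xs) ≡ atMost m xs
  atMost-++-atMost {m} {P} m<P xs = begin
    atMost m (P ++ atMost m xs)            ≡⟨ filter-++ (∁? (m <?_)) P (atMost m xs) ⟩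
    atMost m P ++ atMost m (atMost m xs)   ≡⟨ cong₂ _++_ (filter-none (∁? (m <?_)) P⋠m) (filter-idem (∁? (m <?_)) xs) ⟩
    atMost m xs                            ∎
    where
    open ≡-Reasoning
    P⋠m : All (λ z → ¬ ¬ m < z) P
    P⋠m = All.map (λ m<z z≼m → z≼m m<z) m<P

  skeleton : A → List A → List (Maybe A)
  skeleton m [] = []
  skeleton m (y ∷ ys) with m <? y
  ... | yes _ = nothing ∷ skeleton m ys
  ... | no _ = just y ∷ skeleton y ys

  skeleton-< : ∀ {m y ys} → m < y → skeleton m (y ∷ ys) ≡ nothing ∷ skeleton m ys
  skeleton-< {m} {y} m<y with m <? y
  ... | yes _ = refl
  ... | no y≼m = ⊥-elim (y≼m m<y)

  skeleton-≼ : ∀ {m y ys} → y ≼ m → skeleton m (y ∷ ys) ≡ just y ∷ skeleton y ys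
  skeleton-≼ {m} {y} y≼m with m <? y
  ... | yes m<y = ⊥-elim (y≼m m<y)
  ... | no _ = refl

  -- P is what remains to be placed at the non-minimum positions of xs: letters above the
  -- current minimum m, one for each such position.
  Pool : A → List A → List A → Set
  Pool m P xs = All (m <_) P × length P ≡ length (above m xs)

  initial-pool : ∀ m xs → Pool m (above m xs) xs
  initial-pool m xs = All.all-filter (m <?_) xs , refl

  pool-after-minimum : ∀ {m y P} xs → y ≼ m → Pool m P xs → Pool y (P ++ between y m xs) xs
  pool-after-minimum {m} {y} {P} xs y≼m (m<P , |P|) =
    All.++⁺ (All.map (≼-<-trans y≼m) m<P) (All.all-filter (y <?_) (atMost m xs)) ,
    (begin
      length (P ++ between y m xs)                    ≡⟨ length-++ P ⟩
      length P + length (between y m xs)              ≡⟨ cong (_+ length (between y m xs)) |P| ⟩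
      length (above m xs) + length (between y m xs)   ≡⟨ length-++ (above m xs) ⟨
      length (above m xs ++ between y m xs)           ≡⟨ ↭-length (above-++-between y≼m xs) ⟩
      length (above y xs)                             ∎)
    where open ≡-Reasoning

-- Canonical forms

module Canonical {A : Set} {_<_ : Rel A 0ℓ} (O : IsStrictTotalOrder _≡_ _<_)
                 {_⊏_ : Rel A 0ℓ} (S : IsStrictTotalOrder _≡_ _⊏_) where

  open StrictTotalOrderFacts O
  open LeftToRightMinima O
  private
    module S = StrictTotalOrderFacts S
    ⊑-totalOrder : TotalOrder 0ℓ 0ℓ 0ℓ
    ⊑-totalOrder = record { isTotalOrder = NonStrict.isTotalOrder _≡_ _⊏_ S }
  open Extrema ⊑-totalOrder using (min; argmin-sel; min≤⊤; min≤xs)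

  -- The default m is never returned: the pool is non-empty whenever a letter is taken from it.
  least : A → List A → A
  least m [] = m
  least m (x ∷ xs) = min x xs

  least-∈-∷ : ∀ m x xs → least m (x ∷ xs) ∈ x ∷ xs
  least-∈-∷ m x xs with argmin-sel id x xs
  ... | inj₁ least≡x = here least≡x
  ... | inj₂ least∈xs = there least∈xs

  least-minimal : ∀ m {z P} → z ∈ P → least m P S.≼ z
  least-minimal m {z} {x ∷ xs} z∈ = ⊑⇒≼ (least⊑z z∈)
    where
    least⊑z : z ∈ x ∷ xs → NonStrict._≤_ _≡_ _⊏_ (min x xs) z
    least⊑z (here refl) = min≤⊤ x xs
    least⊑z (there z∈xs) = All.lookup (min≤xs x xs) z∈xs
    ⊑⇒≼ : NonStrict._≤_ _≡_ _⊏_ (min x xs) z → min x xs S.≼ z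
    ⊑⇒≼ (inj₁ least⊏z) z⊏least = S.irrefl refl (S.<-trans z⊏least least⊏z)
    ⊑⇒≼ (inj₂ refl) = S.irrefl refl

  least-↭ : ∀ m {P P′} → P ↭ P′ → least m P ≡ least m P′
  least-↭ m {[]} {[]} _ = refl
  least-↭ m {[]} {_ ∷ _} p = ⊥-elim (¬x∷xs↭[] (↭-sym p))
  least-↭ m {_ ∷ _} {[]} p = ⊥-elim (¬x∷xs↭[] p)
  least-↭ m {x ∷ P} {x′ ∷ P′} p = S.≼-antisym
    (least-minimal m (∈-resp-↭ (↭-sym p) (least-∈-∷ m x′ P′)))
    (least-minimal m (∈-resp-↭ p (least-∈-∷ m x P)))

  delete-least-↭ : ∀ m {P P′} → P ↭ P′ → delete _≟_ (least m P) P ↭ delete _≟_ (least m P′) P′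
  delete-least-↭ m {[]} {[]} _ = ↭-refl
  delete-least-↭ m {[]} {_ ∷ _} p = ⊥-elim (¬x∷xs↭[] (↭-sym p))
  delete-least-↭ m {_ ∷ _} {[]} p = ⊥-elim (¬x∷xs↭[] p)
  delete-least-↭ m {x ∷ P} {x′ ∷ P′} p rewrite least-↭ m p = drop-∷ (begin
    e ∷ delete _≟_ e (x ∷ P)     ↭⟨ delete-↭ _≟_ e∈x∷P ⟨
    x ∷ P                        ↭⟨ p ⟩
    x′ ∷ P′                      ↭⟨ delete-↭ _≟_ (least-∈-∷ m x′ P′) ⟩
    e ∷ delete _≟_ e (x′ ∷ P′)   ∎)
    where
    open PermutationReasoning
    e = least m (x′ ∷ P′)
    e∈x∷P : e ∈ x ∷ P
    e∈x∷P = subst (_∈ x ∷ P) (least-↭ m p) (least-∈-∷ m x P)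

  least-∈ : ∀ m P {n} → length P ≡ suc n → least m P ∈ P
  least-∈ m (x ∷ P) _ = least-∈-∷ m x P

  pool-after-least : ∀ {m P} xs → All (m <_) P → length P ≡ suc (length (above m xs)) →
                     Pool m (delete _≟_ (least m P) P) xs
  pool-after-least {m} {P} _ m<P |P| =
    All.tabulate (All.lookup m<P ∘ delete-⊆ _≟_ P) ,
    suc-injective (trans (sym (↭-length (delete-↭ _≟_ (least-∈ m P |P|)))) |P|)

  fill : ∀ {r} → A → List A → Vec A r → Vec A r
  fill m P [] = []
  fill m P (y ∷ ys) with m <? y
  ... | yes _ = least m P ∷ fill m (delete _≟_ (least m P) P) ys
  ... | no _ = y ∷ fill y (P ++ between y m (toList ys)) ys

  fill-↭ : ∀ {r} m P (ys : Vec A r) → Pool m P (toList ys) →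
           toList (fill m P ys) ↭ P ++ atMost m (toList ys)
  fill-↭ m [] [] _ = ↭-refl
  fill-↭ m (_ ∷ _) [] (_ , ())
  fill-↭ m P (y ∷ ys) (m<P , |P|) with m <? y
  ... | yes _ = begin
    least m P ∷ toList (fill m P′ ys)          ↭⟨ prep (least m P) (fill-↭ m P′ ys (pool-after-least xs m<P |P|)) ⟩
    (least m P ∷ P′) ++ atMost m xs            ↭⟨ ++⁺ʳ (atMost m xs) (delete-↭ _≟_ (least-∈ m P |P|)) ⟨
    P ++ atMost m xs                           ∎
    where
    open PermutationReasoning
    xs = toList ys
    P′ = delete _≟_ (least m P) P
  ... | no y≼m = begin
    y ∷ toList (fill y P′ ys)                  ↭⟨ prep y (fill-↭ y P′ ys (pool-after-minimum xs y≼m (m<P , |P|))) ⟩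
    y ∷ (P ++ between y m xs) ++ atMost y xs   ≡⟨ cong (y ∷_) (++-assoc P (between y m xs) (atMost y xs)) ⟩
    y ∷ P ++ between y m xs ++ atMost y xs     ↭⟨ prep y (++⁺ˡ P (atMost-split y≼m xs)) ⟨
    y ∷ P ++ atMost m xs                       ↭⟨ shift y P (atMost m xs) ⟨
    P ++ y ∷ atMost m xs                       ∎
    where
    open PermutationReasoning
    xs = toList ys
    P′ = P ++ between y m xs

  fill-skeleton : ∀ {r} m P (ys : Vec A r) → Pool m P (toList ys) →
                  skeleton m (toList (fill m P ys)) ≡ skeleton m (toList ys)
  fill-skeleton m P [] _ = refl
  fill-skeleton m P (y ∷ ys) (m<P , |P|) with m <? y
  ... | yes m<y = trans (skeleton-< (All.lookup m<P (least-∈ m P |P|)))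
                        (cong (nothing ∷_) (fill-skeleton m _ ys (pool-after-least (toList ys) m<P |P|)))
  ... | no y≼m = trans (skeleton-≼ y≼m)
                       (cong (just y ∷_) (fill-skeleton y _ ys (pool-after-minimum (toList ys) y≼m (m<P , |P|))))

  fill-cong : ∀ {r} m {P P′} (ys ys′ : Vec A r) → P ↭ P′ →
              skeleton m (toList ys) ≡ skeleton m (toList ys′) →
              atMost m (toList ys) ↭ atMost m (toList ys′) → fill m P ys ≡ fill m P′ ys′
  fill-cong m [] [] _ _ _ = refl
  fill-cong m {P} {P′} (y ∷ ys) (y′ ∷ ys′) P↭P′ same-skeleton ≤m with m <? y | m <? y′
  ... | yes _ | yes _ = cong₂ _∷_ (least-↭ m P↭P′)
                          (fill-cong m ys ys′ (delete-least-↭ m P↭P′) (∷-injectiveʳ same-skeleton) ≤m)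
  ... | yes _ | no _ with () ← same-skeleton
  ... | no _ | yes _ with () ← same-skeleton
  ... | no y≼m | no _ with refl , same-skeleton′ ← ∷-injective same-skeleton =
    cong (y ∷_) (fill-cong y ys ys′ (++⁺ P↭P′ (filter-↭ (y <?_) ≤m′)) same-skeleton′ ≤y)
    where
    ≤m′ : atMost m (toList ys) ↭ atMost m (toList ys′)
    ≤m′ = drop-∷ ≤m
    ≤y : atMost y (toList ys) ↭ atMost y (toList ys′)
    ≤y = subst₂ _↭_ (atMost-atMost y≼m (toList ys)) (atMost-atMost y≼m (toList ys′)) (filter-↭ (∁? (y <?_)) ≤m′)

  -- For ⊏ = < this is the pattern 132 (m < c < b), for ⊏ = flip _<_ the pattern 123.
  Pattern : A → A → A → Set
  Pattern m b c = m < b × m < c × c ⊏ b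

  Pattern-≼ : ∀ {a m b c} → a ≼ m → Pattern m b c → Pattern a b c
  Pattern-≼ a≼m (m<b , m<c , c⊏b) = ≼-<-trans a≼m m<b , ≼-<-trans a≼m m<c , c⊏b

  fill-above-∈ : ∀ {r} m P (ys : Vec A r) → Pool m P (toList ys) →
               ∀ {c} → c ∈ toList (fill m P ys) → m < c → c ∈ P
  fill-above-∈ m P ys pool c∈ m<c with ∈-++⁻ P (∈-resp-↭ (fill-↭ m P ys pool) c∈)
  ... | inj₁ c∈P = c∈P
  ... | inj₂ c∈atMost = ⊥-elim (proj₂ (∈-filter⁻ (∁? (m <?_)) {xs = toList ys} c∈atMost) m<c)

  fill-avoids : ∀ {r} m P (ys : Vec A r) → Pool m P (toList ys) → ¬ Occurs₃ Pattern (m ∷ toList (fill m P ys))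
  fill-avoids m P [] _ (inj₁ ())
  fill-avoids m P [] _ (inj₂ ())
  fill-avoids m P (y ∷ ys) (m<P , |P|) with m <? y
  ... | yes _ = occurrence-impossible
    where
    e = least m P
    P′ = delete _≟_ e P
    pool′ = pool-after-least (toList ys) m<P |P|
    avoids′ = fill-avoids m P′ ys pool′
    m<e : m < e
    m<e = All.lookup m<P (least-∈ m P |P|)
    occurrence-impossible : ¬ Occurs₃ Pattern (m ∷ e ∷ toList (fill m P′ ys))
    occurrence-impossible (inj₁ (inj₁ e…c)) =
      let c , c∈ , (_ , m<c , c⊏e) = find e…c in
      least-minimal m (delete-⊆ _≟_ P (fill-above-∈ m P′ ys pool′ c∈ m<c)) c⊏e
    occurrence-impossible (inj₁ (inj₂ o)) = avoids′ (inj₁ o)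
    occurrence-impossible (inj₂ (inj₁ o)) = avoids′ (inj₁ (Occurs₂-map (Pattern-≼ (asym m<e)) _ o))
    occurrence-impossible (inj₂ (inj₂ o)) = avoids′ (inj₂ o)
  ... | no y≼m = occurrence-impossible
    where
    avoids′ = fill-avoids y _ ys (pool-after-minimum (toList ys) y≼m (m<P , |P|))
    occurrence-impossible : ¬ Occurs₃ Pattern (m ∷ y ∷ toList (fill y (P ++ between y m (toList ys)) ys))
    occurrence-impossible (inj₁ (inj₁ y…c)) = let _ , _ , (m<y , _) = find y…c in y≼m m<y
    occurrence-impossible (inj₁ (inj₂ o)) = avoids′ (inj₁ (Occurs₂-map (Pattern-≼ y≼m) _ o))
    occurrence-impossible (inj₂ o) = avoids′ o

  fill-fixes : ∀ {r} m P (ys : Vec A r) → P ↭ above m (toList ys) → ¬ Occurs₃ Pattern (m ∷ toList ys) →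
               fill m P ys ≡ ys
  fill-fixes m P [] _ _ = refl
  fill-fixes m P (y ∷ ys) P↭ avoids with m <? y
  ... | no y≼m = cong (y ∷_)
    (fill-fixes y _ ys (↭-trans (++⁺ʳ _ P↭) (above-++-between y≼m (toList ys))) (avoids ∘ inj₂))
  ... | yes m<y = cong₂ _∷_ e≡y (fill-fixes m _ ys P′↭ avoids′)
    where
    e = least m P
    e∈P : e ∈ P
    e∈P = least-∈ m P (↭-length P↭)
    e≡y : e ≡ y
    e≡y with ∈-resp-↭ P↭ e∈P
    ... | here e≡y = e≡y
    ... | there e∈above = let e∈ys , m<e = ∈-filter⁻ (m <?_) e∈above in
      S.≼-antisym (least-minimal m (∈-resp-↭ (↭-sym P↭) (here refl)))
                  (λ e⊏y → avoids (inj₁ (inj₁ (lose e∈ys (m<y , m<e , e⊏y)))))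
    P′↭ : delete _≟_ e P ↭ above m (toList ys)
    P′↭ = drop-∷ (↭-trans (↭-sym (delete-↭ _≟_ e∈P))
                          (subst (λ z → P ↭ z ∷ above m (toList ys)) (sym e≡y) P↭))
    avoids′ : ¬ Occurs₃ Pattern (m ∷ toList ys)
    avoids′ (inj₁ o) = avoids (inj₁ (inj₂ o))
    avoids′ (inj₂ o) = avoids (inj₂ (inj₂ o))

  canonical : ∀ {k} → Vec A k → Vec A k
  canonical [] = []
  canonical (a ∷ xs) = a ∷ fill a (above a (toList xs)) xs

  canonical-↭ : ∀ {k} (x : Vec A k) → toList (canonical x) ↭ toList x
  canonical-↭ [] = ↭-refl
  canonical-↭ (a ∷ xs) = prep a (↭-trans (fill-↭ a _ xs (initial-pool a (toList xs)))
                                         (↭-sym (filter-partition-↭ (a <?_) (toList xs))))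

  canonical-avoids : ∀ {k} (x : Vec A k) → ¬ Occurs₃ Pattern (toList (canonical x))
  canonical-avoids [] ()
  canonical-avoids (a ∷ xs) = fill-avoids a _ xs (initial-pool a (toList xs))

  canonical-fixes : ∀ {k} (x : Vec A k) → ¬ Occurs₃ Pattern (toList x) → canonical x ≡ x
  canonical-fixes [] _ = refl
  canonical-fixes (a ∷ xs) avoids = cong (a ∷_) (fill-fixes a _ xs ↭-refl avoids)

module _ {A : Set} {_<_ : Rel A 0ℓ} (O : IsStrictTotalOrder _≡_ _<_)
         {_⊏₁_ _⊏₂_ : Rel A 0ℓ} (S₁ : IsStrictTotalOrder _≡_ _⊏₁_)
         (S₂ : IsStrictTotalOrder _≡_ _⊏₂_) where

  open StrictTotalOrderFacts O
  open LeftToRightMinima O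
  private
    module C₁ = Canonical O S₁
    module C₂ = Canonical O S₂

  canonical-absorbs : ∀ {k} (x : Vec A k) → C₂.canonical (C₁.canonical x) ≡ C₂.canonical x
  canonical-absorbs [] = refl
  canonical-absorbs (a ∷ xs) =
    cong (a ∷_) (C₂.fill-cong a (C₁.fill a P xs) xs above↭ (C₁.fill-skeleton a P xs pool) atMost↭)
    where
    P = above a (toList xs)
    pool = initial-pool a (toList xs)
    out↭ : toList (C₁.fill a P xs) ↭ P ++ atMost a (toList xs)
    out↭ = C₁.fill-↭ a P xs pool
    above↭ : above a (toList (C₁.fill a P xs)) ↭ P
    above↭ = ↭-trans (filter-↭ (a <?_) out↭) (↭-reflexive (above-++-atMost (proj₁ pool) (toList xs)))
    atMost↭ : atMost a (toList (C₁.fill a P xs)) ↭ atMost a (toList xs)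
    atMost↭ = ↭-trans (filter-↭ (∁? (a <?_)) out↭) (↭-reflexive (atMost-++-atMost (proj₁ pool) (toList xs)))

-- Compositions

weakComps-sound : ∀ n k {x : Vec ℕ k} → x ∈ weakComps n k → sum (toList x) ≡ n
weakComps-sound zero zero (here refl) = refl
weakComps-sound n (suc k) x∈
  with find (∈-concatMap⁻ (λ a → map (a ∷_) (weakComps (n ∸ a) k)) {xs = upTo (suc n)} x∈)
... | a , a∈ , x∈′ with ∈-map⁻ (a ∷_) x∈′
...   | xs , xs∈ , refl =
  trans (cong (a +_) (weakComps-sound (n ∸ a) k xs∈)) (m+[n∸m]≡n (s≤s⁻¹ (∈-upTo⁻ a∈)))

weakComps-complete : ∀ n k (x : Vec ℕ k) → sum (toList x) ≡ n → x ∈ weakComps n k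
weakComps-complete .0 zero [] refl = here refl
weakComps-complete n (suc k) (a ∷ xs) refl = ∈-concatMap⁺ (λ a → map (a ∷_) (weakComps (n ∸ a) k))
  (lose (∈-upTo⁺ (s≤s (m≤m+n a (sum (toList xs)))))
        (∈-map⁺ (a ∷_) (weakComps-complete _ k xs (sym (m+n∸m≡n a (sum (toList xs)))))))

weakComps-unique : ∀ n k → Unique (weakComps n k)
weakComps-unique zero zero = [] ∷ []
weakComps-unique (suc n) zero = []
weakComps-unique n (suc k) =
  Unique.concat⁺ (All.map⁺ (All.universal (λ a → Unique.map⁺ Vec.∷-injectiveʳ (weakComps-unique (n ∸ a) k)) _))
                 (AllPairs.map⁺ (AllPairs.map disjoint (Unique.upTo⁺ (suc n))))
  where
  disjoint : ∀ {a b} → a ≢ b → Disjoint (map (a ∷_) (weakComps (n ∸ a) k)) (map (b ∷_) (weakComps (n ∸ b) k))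
  disjoint a≢b (v∈a , v∈b) with ∈-map⁻ (_ ∷_) v∈a | ∈-map⁻ (_ ∷_) v∈b
  ... | _ , _ , refl | _ , _ , v≡ = a≢b (Vec.∷-injectiveˡ v≡)

allPos⁻ : ∀ {k} (x : Vec ℕ k) → T (allPos x) → All (0 <_) (toList x)
allPos⁻ [] _ = []
allPos⁻ (a ∷ xs) t = let 0<a , rest = to T-∧ t in <ᵇ⇒< 0 a 0<a ∷ allPos⁻ xs rest

allPos⁺ : ∀ {k} (x : Vec ℕ k) → All (0 <_) (toList x) → T (allPos x)
allPos⁺ [] _ = _
allPos⁺ (a ∷ xs) (0<a ∷ rest) = from T-∧ (<⇒<ᵇ 0<a , allPos⁺ xs rest)

module _ {n k : ℕ} {x y : Vec ℕ k} (y↭x : toList y ↭ toList x) where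

  weakComps-↭-closed : x ∈ weakComps n k → y ∈ weakComps n k
  weakComps-↭-closed x∈ = weakComps-complete n k y (trans (sum-↭ y↭x) (weakComps-sound n k x∈))

  comps-↭-closed : x ∈ comps n k → y ∈ comps n k
  comps-↭-closed x∈ = let x∈W , pos = ∈-filter⁻ (T? ∘ allPos) {xs = weakComps n k} x∈ in
    ∈-filter⁺ (T? ∘ allPos) (weakComps-↭-closed x∈W) (allPos⁺ y (All-resp-↭ (↭-sym y↭x) (allPos⁻ x pos)))

countWith : ∀ {k} → (Vec ℕ k → Bool) → List (Vec ℕ k) → ℕ
countWith p L = length (filter (T? ∘ p) L)

Avoidance : Set
Avoidance = ∀ {k} → Vec ℕ k → Bool

SameCounts : Avoidance → Avoidance → Set
SameCounts p q = ∀ n k → countWith p (comps n k) ≡ countWith q (comps n k)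
                        × countWith p (weakComps n k) ≡ countWith q (weakComps n k)

SameCounts-sym : ∀ {p q : Avoidance} → SameCounts p q → SameCounts q p
SameCounts-sym p~q n k = let pos , nonneg = p~q n k in sym pos , sym nonneg

SameCounts-trans : ∀ {p q r : Avoidance} → SameCounts p q → SameCounts q r → SameCounts p r
SameCounts-trans p~q q~r n k = let pos₁ , nonneg₁ = p~q n k ; pos₂ , nonneg₂ = q~r n k in
  trans pos₁ pos₂ , trans nonneg₁ nonneg₂

SameCounts-by-rearrangements : (p q : Avoidance) (f g : ∀ {k} → Vec ℕ k → Vec ℕ k) →
  (∀ {k} (x : Vec ℕ k) → toList (f x) ↭ toList x) → (∀ {k} (x : Vec ℕ k) → toList (g x) ↭ toList x) →
  (∀ {k} (x : Vec ℕ k) → T (p x) → T (q (f x))) → (∀ {k} (x : Vec ℕ k) → T (q x) → T (p (g x))) →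
  (∀ {k} (x : Vec ℕ k) → T (p x) → g (f x) ≡ x) → (∀ {k} (x : Vec ℕ k) → T (q x) → f (g x) ≡ x) →
  SameCounts p q
SameCounts-by-rearrangements p q f g f↭ g↭ f-pq g-qp g∘f≗id f∘g≗id n k =
  count-≡ (Unique.filter⁺ (T? ∘ allPos) (weakComps-unique n k)) comps-↭-closed ,
  count-≡ (weakComps-unique n k) weakComps-↭-closed
  where
  count-≡ : ∀ {L : List (Vec ℕ k)} → Unique L → (∀ {x y} → toList y ↭ toList x → x ∈ L → y ∈ L) →
            countWith p L ≡ countWith q L
  count-≡ L! closed = length-filter-≡ (Vec.≡-dec _≟ℕ_) (T? ∘ p) (T? ∘ q) L! f g
    (λ x∈ px → closed (f↭ _) x∈ , f-pq _ px) (λ x∈ qx → closed (g↭ _) x∈ , g-qp _ qx)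
    (g∘f≗id _) (f∘g≗id _)

Decides : Avoidance → (ℕ → ℕ → ℕ → Set) → Set
Decides p C = ∀ {k} (x : Vec ℕ k) → T (p x) ⇔ (¬ Occurs₃ C (toList x))

module _ {_<_ : Rel ℕ 0ℓ} (O : IsStrictTotalOrder _≡_ _<_)
         {_⊏₁_ _⊏₂_ : Rel ℕ 0ℓ} (S₁ : IsStrictTotalOrder _≡_ _⊏₁_)
         (S₂ : IsStrictTotalOrder _≡_ _⊏₂_) where

  private
    module C₁ = Canonical O S₁
    module C₂ = Canonical O S₂

  SameCounts-canonical : ∀ {p q : Avoidance} → Decides p C₁.Pattern → Decides q C₂.Pattern → SameCounts p q
  SameCounts-canonical {p} {q} p⇔ q⇔ = SameCounts-by-rearrangements p q C₂.canonical C₁.canonical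
    C₂.canonical-↭ C₁.canonical-↭
    (λ x _ → from (q⇔ _) (C₂.canonical-avoids x))
    (λ x _ → from (p⇔ _) (C₁.canonical-avoids x))
    (λ x px → trans (canonical-absorbs O S₂ S₁ x) (C₁.canonical-fixes x (to (p⇔ x) px)))
    (λ x qx → trans (canonical-absorbs O S₁ S₂ x) (C₂.canonical-fixes x (to (q⇔ x) qx)))

SameCounts-reverse : ∀ {p q : Avoidance} {C D : ℕ → ℕ → ℕ → Set} → Decides p C → Decides q D →
                     (∀ {a b c} → C a b c → D c b a) → (∀ {a b c} → D a b c → C c b a) → SameCounts p q
SameCounts-reverse {p} {q} p⇔ q⇔ C⇒D D⇒C =
  SameCounts-by-rearrangements p q Vec.reverse Vec.reverse reverse-↭ reverse-↭
    (λ x px → from (q⇔ _) (reverse-avoids p⇔ D⇒C x px))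
    (λ x qx → from (p⇔ _) (reverse-avoids q⇔ C⇒D x qx))
    (λ x _ → Vec.reverse-involutive x) (λ x _ → Vec.reverse-involutive x)
  where
  reverse-↭ : ∀ {k} (x : Vec ℕ k) → toList (Vec.reverse x) ↭ toList x
  reverse-↭ x = subst (_↭ toList x) (sym (Vec.toList-reverse x)) (↭-reverse (toList x))
  reverse-avoids : ∀ {r : Avoidance} {E F : ℕ → ℕ → ℕ → Set} → Decides r E →
                   (∀ {a b c} → F a b c → E c b a) →
                   ∀ {k} (x : Vec ℕ k) → T (r x) → ¬ Occurs₃ F (toList (Vec.reverse x))
  reverse-avoids r⇔ F⇒E x rx o = to (r⇔ x) rx
    (Occurs₃-map F⇒E (toList x) (Occurs₃-reverse (toList x) (subst (Occurs₃ _) (Vec.toList-reverse x) o)))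

-- Reading the Boolean pattern test of Defs

fin3 : {X : Set} → X → X → X → Fin 3 → X
fin3 a b c zero = a
fin3 a b c (suc zero) = b
fin3 a b c (suc (suc zero)) = c

matches : (Fin 3 → Fin 3) → ℕ → ℕ → ℕ → Bool
matches t p q r = allL (λ a → allL (λ b →
  not (toℕ (t a) <ᵇ toℕ (t b)) ∨ (fin3 p q r a <ᵇ fin3 p q r b)) (allFin 3)) (allFin 3)

containsBy : ∀ {k} → (ℕ → ℕ → ℕ → Bool) → Vec ℕ k → Bool
containsBy {k} g x = anyL (λ i₁ → anyL (λ i₂ → anyL (λ i₃ →
  (toℕ i₁ <ᵇ toℕ i₂) ∧ (toℕ i₂ <ᵇ toℕ i₃) ∧ g (lookup x i₁) (lookup x i₂) (lookup x i₃))
  (allFin k)) (allFin k)) (allFin k)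

avoidsPattern : Fin 3 → Fin 3 → Fin 3 → Avoidance
avoidsPattern a b c x = not (containsBy (matches (fin3 a b c)) x)

T-anyL-allFin : ∀ {n} (p : Fin n → Bool) → T (anyL p (allFin n)) ⇔ ∃ (T ∘ p)
T-anyL-allFin {n} p = mk⇔ (λ t → Any.tabulate⁻ (to-Any (allFin n) t))
                          (λ (i , pi) → from-Any (allFin n) (Any.tabulate⁺ {f = id} i pi))
  where
  to-Any : ∀ xs → T (anyL p xs) → Any (T ∘ p) xs
  to-Any (x ∷ xs) t with to T-∨ t
  ... | inj₁ px = here px
  ... | inj₂ pxs = there (to-Any xs pxs)
  from-Any : ∀ xs → Any (T ∘ p) xs → T (anyL p xs)
  from-Any (x ∷ xs) (here px) = from T-∨ (inj₁ px)
  from-Any (x ∷ xs) (there pxs) = from T-∨ (inj₂ (from-Any xs pxs))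

T-not : ∀ {b} → T (not b) ⇔ (¬ T b)
T-not {false} = mk⇔ (λ _ ()) (λ _ → _)
T-not {true} = mk⇔ (λ ()) (λ ¬t → ¬t _)

module _ {P : ℕ → Set} where

  Any-toList⁻ : ∀ {k} (x : Vec ℕ k) → Any P (toList x) → ∃ λ i → P (lookup x i)
  Any-toList⁻ (a ∷ xs) (here pa) = zero , pa
  Any-toList⁻ (a ∷ xs) (there p) = let i , pi = Any-toList⁻ xs p in suc i , pi

  Any-toList⁺ : ∀ {k} (x : Vec ℕ k) i → P (lookup x i) → Any P (toList x)
  Any-toList⁺ (a ∷ xs) zero pa = here pa
  Any-toList⁺ (a ∷ xs) (suc i) pi = there (Any-toList⁺ xs i pi)

module _ {C : ℕ → ℕ → Set} where

  Occurs₂-lookup⁻ : ∀ {k} (x : Vec ℕ k) → Occurs₂ C (toList x) →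
                    ∃₂ λ i j → i <ᶠ j × C (lookup x i) (lookup x j)
  Occurs₂-lookup⁻ (a ∷ xs) (inj₁ a…c) = let j , c = Any-toList⁻ xs a…c in zero , suc j , z<s , c
  Occurs₂-lookup⁻ (a ∷ xs) (inj₂ o) = let i , j , i<j , c = Occurs₂-lookup⁻ xs o in suc i , suc j , s<s i<j , c

  Occurs₂-lookup⁺ : ∀ {k} (x : Vec ℕ k) i j → i <ᶠ j → C (lookup x i) (lookup x j) → Occurs₂ C (toList x)
  Occurs₂-lookup⁺ (a ∷ xs) zero (suc j) _ c = inj₁ (Any-toList⁺ xs j c)
  Occurs₂-lookup⁺ (a ∷ xs) (suc i) (suc j) i<j c = inj₂ (Occurs₂-lookup⁺ xs i j (s<s⁻¹ i<j) c)

module _ {C : ℕ → ℕ → ℕ → Set} where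

  Occurs₃-lookup⁻ : ∀ {k} (x : Vec ℕ k) → Occurs₃ C (toList x) →
                    ∃₂ λ i j → ∃ λ l → i <ᶠ j × j <ᶠ l × C (lookup x i) (lookup x j) (lookup x l)
  Occurs₃-lookup⁻ (a ∷ xs) (inj₁ o) =
    let j , l , j<l , c = Occurs₂-lookup⁻ xs o in zero , suc j , suc l , z<s , s<s j<l , c
  Occurs₃-lookup⁻ (a ∷ xs) (inj₂ o) =
    let i , j , l , i<j , j<l , c = Occurs₃-lookup⁻ xs o in suc i , suc j , suc l , s<s i<j , s<s j<l , c

  Occurs₃-lookup⁺ : ∀ {k} (x : Vec ℕ k) i j l → i <ᶠ j → j <ᶠ l →
                    C (lookup x i) (lookup x j) (lookup x l) → Occurs₃ C (toList x)
  Occurs₃-lookup⁺ (a ∷ xs) zero (suc j) (suc l) _ j<l c = inj₁ (Occurs₂-lookup⁺ xs j l (s<s⁻¹ j<l) c)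
  Occurs₃-lookup⁺ (a ∷ xs) (suc i) (suc j) (suc l) i<j j<l c =
    inj₂ (Occurs₃-lookup⁺ xs i j l (s<s⁻¹ i<j) (s<s⁻¹ j<l) c)

T-containsBy : ∀ {k} (g : ℕ → ℕ → ℕ → Bool) (x : Vec ℕ k) →
               T (containsBy g x) ⇔ Occurs₃ (λ a b c → T (g a b c)) (toList x)
T-containsBy g x = mk⇔ occurrence search
  where
  occurrence : T (containsBy g x) → Occurs₃ _ (toList x)
  occurrence t =
    let i , t₁ = to (T-anyL-allFin _) t
        j , t₂ = to (T-anyL-allFin _) t₁
        l , t₃ = to (T-anyL-allFin _) t₂
        i<j , t₄ = to T-∧ t₃
        j<l , c = to T-∧ t₄
    in Occurs₃-lookup⁺ x i j l (<ᵇ⇒< _ _ i<j) (<ᵇ⇒< _ _ j<l) c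
  search : Occurs₃ _ (toList x) → T (containsBy g x)
  search o = let i , j , l , i<j , j<l , c = Occurs₃-lookup⁻ x o in
    from (T-anyL-allFin _) (i , from (T-anyL-allFin _) (j ,
    from (T-anyL-allFin _) (l , from T-∧ (<⇒<ᵇ i<j , from T-∧ (<⇒<ᵇ j<l , c)))))

avoidsPattern-decides : ∀ a b c {C : ℕ → ℕ → ℕ → Set} →
  (∀ p q r → T (matches (fin3 a b c) p q r) ⇔ C p q r) → Decides (avoidsPattern a b c) C
avoidsPattern-decides _ _ _ matches⇔C x = mk⇔
  (λ t o → to T-not t (from (T-containsBy _ x) (Occurs₃-map (from (matches⇔C _ _ _)) _ o)))
  (λ ¬o → from T-not λ t → ¬o (Occurs₃-map (to (matches⇔C _ _ _)) _ (to (T-containsBy _ x) t)))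

-- matches (fin3 a b c) p q r normalises to one of these two shapes.
T-conj₁ : ∀ {x y z} → T ((x ∧ y ∧ true) ∧ (z ∧ true) ∧ true) ⇔ (T x × T y × T z)
T-conj₁ {true} {true} {true} = mk⇔ _ _
T-conj₁ {false} = mk⇔ (λ ()) proj₁
T-conj₁ {true} {false} = mk⇔ (λ ()) (proj₁ ∘ proj₂)
T-conj₁ {true} {true} {false} = mk⇔ (λ ()) (proj₂ ∘ proj₂)

T-conj₂ : ∀ {x y z} → T ((x ∧ true) ∧ (y ∧ z ∧ true) ∧ true) ⇔ (T x × T y × T z)
T-conj₂ {true} {true} {true} = mk⇔ _ _
T-conj₂ {false} = mk⇔ (λ ()) proj₁
T-conj₂ {true} {false} = mk⇔ (λ ()) (proj₁ ∘ proj₂)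
T-conj₂ {true} {true} {false} = mk⇔ (λ ()) (proj₂ ∘ proj₂)

T-<ᵇ : ∀ {m n} → T (m <ᵇ n) ⇔ m < n
T-<ᵇ = mk⇔ (<ᵇ⇒< _ _) <⇒<ᵇ

T-<ᵇ³ : ∀ {a b c d e f} → (T (a <ᵇ b) × T (c <ᵇ d) × T (e <ᵇ f)) ⇔ (a < b × c < d × e < f)
T-<ᵇ³ = T-<ᵇ ×-⇔ T-<ᵇ ×-⇔ T-<ᵇ

Pattern123 Pattern132 Pattern213 Pattern231 Pattern312 Pattern321 : ℕ → ℕ → ℕ → Set
Pattern123 p q r = p < q × p < r × q < r
Pattern132 p q r = p < q × p < r × r < q
Pattern213 p q r = p < r × q < p × q < r
Pattern231 p q r = p < q × r < p × r < q
Pattern312 p q r = q < p × r < p × q < r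
Pattern321 p q r = q < p × r < p × r < q

pattern 0F = zero
pattern 1F = suc zero
pattern 2F = suc (suc zero)

avoids123 avoids132 avoids213 avoids231 avoids312 avoids321 : Avoidance
avoids123 = avoidsPattern 0F 1F 2F
avoids132 = avoidsPattern 0F 2F 1F
avoids213 = avoidsPattern 1F 0F 2F
avoids231 = avoidsPattern 1F 2F 0F
avoids312 = avoidsPattern 2F 0F 1F
avoids321 = avoidsPattern 2F 1F 0F

decides123 : Decides avoids123 Pattern123
decides123 = avoidsPattern-decides 0F 1F 2F λ _ _ _ → ⇔-trans T-conj₁ T-<ᵇ³

decides132 : Decides avoids132 Pattern132
decides132 = avoidsPattern-decides 0F 2F 1F λ _ _ _ → ⇔-trans T-conj₁ T-<ᵇ³

decides213 : Decides avoids213 Pattern213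
decides213 = avoidsPattern-decides 1F 0F 2F λ _ _ _ → ⇔-trans T-conj₂ T-<ᵇ³

decides231 : Decides avoids231 Pattern231
decides231 = avoidsPattern-decides 1F 2F 0F λ _ _ _ → ⇔-trans T-conj₂ T-<ᵇ³

decides312 : Decides avoids312 Pattern312
decides312 = avoidsPattern-decides 2F 0F 1F λ _ _ _ → ⇔-trans (⇔-trans T-conj₁ T-<ᵇ³)
  (mk⇔ (λ (x , y , z) → x , z , y) (λ (x , y , z) → x , z , y))

decides321 : Decides avoids321 Pattern321
decides321 = avoidsPattern-decides 2F 1F 0F λ _ _ _ → ⇔-trans T-conj₂ T-<ᵇ³

<-sto : IsStrictTotalOrder _≡_ _<_
<-sto = <-isStrictTotalOrder

>-sto : IsStrictTotalOrder _≡_ (flip _<_)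
>-sto = Flip.isStrictTotalOrder <-sto

123~132 : SameCounts avoids123 avoids132
123~132 = SameCounts-canonical <-sto >-sto <-sto decides123 decides132

321~312 : SameCounts avoids321 avoids312
321~312 = SameCounts-canonical >-sto <-sto >-sto decides321 decides312

123~321 : SameCounts avoids123 avoids321
123~321 = SameCounts-reverse decides123 decides321
  (λ (x , y , z) → z , y , x) (λ (x , y , z) → z , y , x)

132~231 : SameCounts avoids132 avoids231
132~231 = SameCounts-reverse decides132 decides231
  (λ (x , y , z) → z , y , x) (λ (x , y , z) → z , y , x)

312~213 : SameCounts avoids312 avoids213
312~213 = SameCounts-reverse decides312 decides213
  (λ (x , y , z) → y , z , x) (λ (x , y , z) → z , x , y)

avoidsPattern~123 : ∀ a b c → a ≢ b → a ≢ c → b ≢ c → SameCounts (avoidsPattern a b c) avoids123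
avoidsPattern~123 0F 1F 2F _ _ _ = λ _ _ → refl , refl
avoidsPattern~123 0F 2F 1F _ _ _ = SameCounts-sym 123~132
avoidsPattern~123 1F 0F 2F _ _ _ = SameCounts-sym (SameCounts-trans 123~321 (SameCounts-trans 321~312 312~213))
avoidsPattern~123 1F 2F 0F _ _ _ = SameCounts-sym (SameCounts-trans 123~132 132~231)
avoidsPattern~123 2F 0F 1F _ _ _ = SameCounts-sym (SameCounts-trans 123~321 321~312)
avoidsPattern~123 2F 1F 0F _ _ _ = SameCounts-sym 123~321
avoidsPattern~123 0F 0F _ a≢b _ _ = ⊥-elim (a≢b refl)
avoidsPattern~123 1F 1F _ a≢b _ _ = ⊥-elim (a≢b refl)
avoidsPattern~123 2F 2F _ a≢b _ _ = ⊥-elim (a≢b refl)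
avoidsPattern~123 0F _ 0F _ a≢c _ = ⊥-elim (a≢c refl)
avoidsPattern~123 1F _ 1F _ a≢c _ = ⊥-elim (a≢c refl)
avoidsPattern~123 2F _ 2F _ a≢c _ = ⊥-elim (a≢c refl)
avoidsPattern~123 _ 0F 0F _ _ b≢c = ⊥-elim (b≢c refl)
avoidsPattern~123 _ 1F 1F _ _ b≢c = ⊥-elim (b≢c refl)
avoidsPattern~123 _ 2F 2F _ _ b≢c = ⊥-elim (b≢c refl)

-- avoids π is definitionally avoidsPattern (π ⟨$⟩ʳ 0F) (π ⟨$⟩ʳ 1F) (π ⟨$⟩ʳ 2F).
avoids~123 : ∀ (π : Perm3) → SameCounts (λ {k} → avoids {k} π) avoids123
avoids~123 π = avoidsPattern~123 _ _ _ (distinct λ ()) (distinct λ ()) (distinct λ ())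
  where
  distinct : ∀ {i j} → i ≢ j → π ⟨$⟩ʳ i ≢ π ⟨$⟩ʳ j
  distinct i≢j πi≡πj = i≢j (Injection.injective (↔⇒↣ π) πi≡πj)

theorem2 : (n k : ℕ) → k ≥ 1 → (π σ : Perm3) →
    (countPos π n k ≡ countPos σ n k) × (countNonneg π n k ≡ countNonneg σ n k)
theorem2 n k _ π σ = SameCounts-trans (avoids~123 π) (SameCounts-sym (avoids~123 σ)) n k
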